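{- Let $a_n=|B_n(231,312,321)|$. Then $a_1=a_2=1$ and $a_n=a_{n-1}+a_{n-2}$ for all $n\ge 3$; that is, $a_n$ is the $n$-th Fibonacci number.
   Context: A permutation $\sigma\in S_n$ is written as $\sigma(1)\cdots\sigma(n)$. An index $i\in[n-1]$ is an ascent if $\sigma(i)<\sigma(i+1)$ and a descent if $\sigma(i)>\sigma(i+1)$. A ballot permutation is a permutation such that every prefix $\sigma(1)\cdots\sigma(p)$ has at least as many ascents as descents. $\sigma$ contains a pattern $\pi\in S_k$ if some subsequence $\sigma(c_1)\cdots\sigma(c_k)$ with $c_1<\dots<c_k$ is order-isomorphic to $\pi$, and avoids $\pi$ otherwise. $B_n(\pi_1,\dots,\pi_m)$ denotes the set of ballot permutations of length $n$ avoiding all of $\pi_1,\dots,\pi_m$. -}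

module Defs where

open import Data.Nat using (ℕ; zero; suc; _+_; _<_; _≤_; _<ᵇ_)
open import Data.Bool using (if_then_else_)
open import Data.List using (List; []; _∷_; length; take; map; upTo; zip)
open import Data.List.Relation.Binary.Permutation.Propositional using (_↭_)
open import Data.List.Relation.Binary.Sublist.Propositional using (_⊆_)
open import Data.List.Relation.Unary.AllPairs using (AllPairs)
open import Data.List.Relation.Unary.Unique.Propositional using (Unique)
open import Data.List.Membership.Propositional using (_∈_)
open import Data.Product using (Σ; ∃; _×_; _,_)
open import Relation.Binary.PropositionalEquality using (_≡_)
open import Relation.Nullary using (¬_)

IsPerm : ℕ → List ℕ → Set
IsPerm n σ = σ ↭ map suc (upTo n)

asc : List ℕ → ℕ
asc (x ∷ y ∷ xs) = (if x <ᵇ y then 1 else 0) + asc (y ∷ xs)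
asc _ = 0

des : List ℕ → ℕ
des (x ∷ y ∷ xs) = (if y <ᵇ x then 1 else 0) + des (y ∷ xs)
des _ = 0

Ballot : List ℕ → Set
Ballot σ = ∀ p → des (take p σ) ≤ asc (take p σ)

-- two words of the same length are order-isomorphic: for all positions i < j,
-- τ(i) < τ(j) iff π(i) < π(j)   (words with distinct entries)
SameOrder : ℕ × ℕ → ℕ × ℕ → Set
SameOrder (a , b) (c , d) = (a < c → b < d) × (b < d → a < c)

OrderIso : List ℕ → List ℕ → Set
OrderIso τ π = (length τ ≡ length π) × AllPairs SameOrder (zip τ π)

Contains : List ℕ → List ℕ → Set
Contains σ π = ∃ λ τ → (τ ⊆ σ) × OrderIso τ π

Avoids : List ℕ → List ℕ → Set
Avoids σ π = ¬ Contains σ π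

p231 p312 p321 : List ℕ
p231 = 2 ∷ 3 ∷ 1 ∷ []
p312 = 3 ∷ 1 ∷ 2 ∷ []
p321 = 3 ∷ 2 ∷ 1 ∷ []

InB : ℕ → List ℕ → Set
InB n σ = IsPerm n σ × Ballot σ × Avoids σ p231 × Avoids σ p312 × Avoids σ p321

HasCard : (List ℕ → Set) → ℕ → Set
HasCard P k = Σ (List (List ℕ)) λ L →
  Unique L × (∀ σ → (σ ∈ L → P σ) × (P σ → σ ∈ L)) × (length L ≡ k)

fib : ℕ → ℕ
fib 0 = 0
fib 1 = 1
fib (suc (suc n)) = fib (suc n) + fib n

-- The elements of B_n(231,312,321) are the layered permutations whose layers
-- have size 1 or 2 (1 2 ⋯ with some adjacent pairs swapped), and the ballot
-- condition only forbids a first layer 2 1.  Hence they are 1 followed by a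
-- tiling of the remaining n − 1 values by layers of size 1 and 2, of which
-- there are fib n.
module Submission where

open import Defs
open import Data.Nat using (ℕ; zero; suc; _+_; _<_; _≤_; _<ᵇ_; z≤n; s≤s; z<s; s<s)
open import Data.Nat.Properties
  using ( +-identityʳ; +-suc; ≤-refl; ≤-trans; ≤-reflexive; <-trans; <-asym; <⇒≢
        ; n<1+n; n≤1+n; m≤n⇒m≤1+n; 1+n≢n; <⇒<ᵇ; <ᵇ⇒<)
open import Data.Bool using (true; false; T)
open import Data.Bool.Properties using (T-≡)
open import Data.List using (List; []; _∷_; [_]; length; take; drop; map; upTo; applyUpTo; _++_)
open import Data.List.Properties using (map-applyUpTo; length-++; length-map; ∷-injectiveˡ; ∷-injectiveʳ)
open import Data.List.Relation.Unary.All as All using (All; []; _∷_)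
open import Data.List.Relation.Unary.All.Properties using (drop⁺)
open import Data.List.Relation.Unary.Any using (here; there)
open import Data.List.Relation.Unary.AllPairs using ([]; _∷_)
open import Data.List.Relation.Unary.Unique.Propositional using (Unique)
open import Data.List.Relation.Binary.Disjoint.Propositional using (Disjoint)
import Data.List.Relation.Unary.Unique.Propositional.Properties as Unique
open import Data.List.Membership.Propositional using (_∈_)
open import Data.List.Membership.Propositional.Properties using (∈-map⁺; ∈-map⁻; ∈-++⁺ˡ; ∈-++⁺ʳ; ∈-++⁻)
open import Data.List.Relation.Binary.Permutation.Propositional using (_↭_; refl; prep; swap; trans; ↭-sym; ↭⇒↭ₛ)
open import Data.List.Relation.Binary.Permutation.Propositional.Properties using (∈-resp-↭; drop-∷; ¬x∷xs↭[])
open import Data.List.Relation.Binary.Permutation.Setoid.Properties using (Unique-resp-↭)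
open import Data.List.Relation.Binary.Sublist.Propositional using (_⊆_; []; _∷_; _∷ʳ_; from∈; to∈)
open import Data.List.Relation.Binary.Sublist.Propositional.Properties using (∷ˡ⁻)
open import Data.Product using (_×_; _,_; proj₁)
open import Data.Sum as Sum using (_⊎_; inj₁; inj₂)
open import Data.Empty using (⊥-elim)
open import Function using (_∘_; Equivalence)
open import Relation.Nullary using (¬_)
open import Relation.Binary.PropositionalEquality
  using (_≡_; _≢_; refl; sym; cong; cong₂; subst; subst₂; setoid; module ≡-Reasoning)
  renaming (trans to ≡-trans)

interval : ℕ → ℕ → List ℕ
interval o zero    = []
interval o (suc m) = suc o ∷ interval (suc o) m

applyUpTo-interval : ∀ (f : ℕ → ℕ) o m → (∀ i → f i ≡ suc (o + i)) → applyUpTo f m ≡ interval o m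
applyUpTo-interval f o zero    _  = refl
applyUpTo-interval f o (suc m) f≗ = cong₂ _∷_
  (≡-trans (f≗ 0) (cong suc (+-identityʳ o)))
  (applyUpTo-interval (f ∘ suc) (suc o) m (λ i → ≡-trans (f≗ (suc i)) (cong suc (+-suc o i))))

map-suc-upTo : ∀ n → map suc (upTo n) ≡ interval 0 n
map-suc-upTo n = ≡-trans (map-applyUpTo (λ i → i) suc n) (applyUpTo-interval suc 0 n (λ _ → refl))

interval-lower : ∀ {o m y} → y ∈ interval o m → o < y
interval-lower {m = suc m} (here refl) = n<1+n _
interval-lower {m = suc m} (there y∈) = <-trans (n<1+n _) (interval-lower y∈)

interval-unique : ∀ o m → Unique (interval o m)
interval-unique o zero    = []
interval-unique o (suc m) = All.tabulate (<⇒≢ ∘ interval-lower) ∷ interval-unique (suc o) m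

↭-interval-unique : ∀ {o m σ} → σ ↭ interval o m → Unique σ
↭-interval-unique {o} {m} p = Unique-resp-↭ (setoid ℕ) (↭⇒↭ₛ (↭-sym p)) (interval-unique o m)

∈-tail : ∀ {z x : ℕ} {τ} → z ∈ x ∷ τ → z ≢ x → z ∈ τ
∈-tail (here z≡x) z≢x = ⊥-elim (z≢x z≡x)
∈-tail (there z∈) _   = z∈

data Layered : ℕ → ℕ → List ℕ → Set where
  []     : ∀ {o} → Layered o 0 []
  layer₁ : ∀ {o m w} → Layered (suc o) m w → Layered o (suc m) (suc o ∷ w)
  layer₂ : ∀ {o m w} → Layered (suc (suc o)) m w → Layered o (suc (suc m)) (suc (suc o) ∷ suc o ∷ w)

Layered⇒↭ : ∀ {o m w} → Layered o m w → w ↭ interval o m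
Layered⇒↭ []         = refl
Layered⇒↭ (layer₁ l) = prep _ (Layered⇒↭ l)
Layered⇒↭ (layer₂ l) = swap _ _ (Layered⇒↭ l)

Layered⇒above : ∀ {o m w} → Layered o m w → All (o <_) w
Layered⇒above l = All.tabulate (interval-lower ∘ ∈-resp-↭ (Layered⇒↭ l))

<ᵇ-true : ∀ {m n} → m < n → (m <ᵇ n) ≡ true
<ᵇ-true = Equivalence.to T-≡ ∘ <⇒<ᵇ

<ᵇ-false : ∀ {m n} → n < m → (m <ᵇ n) ≡ false
<ᵇ-false {m} {n} n<m with m <ᵇ n in eq
... | false = refl
... | true  = ⊥-elim (<-asym n<m (<ᵇ⇒< m n (subst T (sym eq) _)))

module _ {x y : ℕ} (w : List ℕ) where

  asc-up : x < y → asc (x ∷ y ∷ w) ≡ suc (asc (y ∷ w))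
  asc-up x<y rewrite <ᵇ-true x<y = refl

  des-up : x < y → des (x ∷ y ∷ w) ≡ des (y ∷ w)
  des-up x<y rewrite <ᵇ-false x<y = refl

  asc-down : y < x → asc (x ∷ y ∷ w) ≡ asc (y ∷ w)
  asc-down y<x rewrite <ᵇ-false y<x = refl

  des-down : y < x → des (x ∷ y ∷ w) ≡ suc (des (y ∷ w))
  des-down y<x rewrite <ᵇ-true y<x = refl

Layered-ballot : ∀ {o m w x} → x ≤ o → Layered o m w → Ballot (x ∷ w)
Layered-ballot _ _ zero = z≤n
Layered-ballot _ _ (suc zero) = z≤n
Layered-ballot _ [] (suc (suc p)) = z≤n
Layered-ballot x≤o (layer₁ {w = w} l) (suc (suc p)) =
  subst₂ _≤_ (sym (des-up (take p w) (s≤s x≤o))) (sym (asc-up (take p w) (s≤s x≤o)))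
    (m≤n⇒m≤1+n (Layered-ballot ≤-refl l (suc p)))
Layered-ballot x≤o (layer₂ l) (suc (suc zero)) =
  ≤-trans (≤-reflexive (des-up [] (s≤s (m≤n⇒m≤1+n x≤o)))) z≤n
Layered-ballot {o} {x = x} x≤o (layer₂ {w = w} l) (suc (suc (suc p))) =
  subst₂ _≤_ (sym (≡-trans (des-up (suc o ∷ t) x<o+2) (des-down t ≤-refl)))
             (sym (≡-trans (asc-up (suc o ∷ t) x<o+2) (cong suc (asc-down t ≤-refl))))
    (s≤s (Layered-ballot (n≤1+n _) l (suc p)))
  where
  t : List ℕ
  t = take p w
  x<o+2 : x < suc (suc o)
  x<o+2 = s≤s (m≤n⇒m≤1+n x≤o)

-- 231, 312 and 321 are exactly the patterns of length 3 whose last entry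
-- is below the first.
Ascending₁₃ : List ℕ → Set
Ascending₁₃ σ = ∀ {a b c} → (a ∷ b ∷ c ∷ []) ⊆ σ → a < c

second∈tail : ∀ {b c y : ℕ} {ys} → (b ∷ c ∷ []) ⊆ y ∷ ys → c ∈ ys
second∈tail (_ ∷ s)  = to∈ s
second∈tail (_ ∷ʳ s) = to∈ (∷ˡ⁻ s)

∷-ascending₁₃ : ∀ {h w} → All (h <_) (drop 1 w) → Ascending₁₃ w → Ascending₁₃ (h ∷ w)
∷-ascending₁₃ _ asc₁₃ (_ ∷ʳ s) = asc₁₃ s
∷-ascending₁₃ {w = _ ∷ _} h< _ (refl ∷ s) = All.lookup h< (second∈tail s)

Layered⇒ascending₁₃ : ∀ {o m w} → Layered o m w → Ascending₁₃ w
Layered⇒ascending₁₃ [] ()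
Layered⇒ascending₁₃ (layer₁ l) = ∷-ascending₁₃ (drop⁺ 1 (Layered⇒above l)) (Layered⇒ascending₁₃ l)
Layered⇒ascending₁₃ (layer₂ l) = ∷-ascending₁₃ (Layered⇒above l)
  (∷-ascending₁₃ (drop⁺ 1 (All.map (<-trans (n<1+n _)) (Layered⇒above l))) (Layered⇒ascending₁₃ l))

ascending₁₃⇒avoids : ∀ {σ p q r} → Ascending₁₃ σ → r < p → Avoids σ (p ∷ q ∷ r ∷ [])
ascending₁₃⇒avoids asc₁₃ r<p (_ ∷ _ ∷ _ ∷ [] , s , refl , (_ ∷ (a<c⇒p<r , _) ∷ []) ∷ _) =
  <-asym r<p (a<c⇒p<r (asc₁₃ s))

Avoids₃ : List ℕ → Set
Avoids₃ σ = Avoids σ p231 × Avoids σ p312 × Avoids σ p321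

avoids-tail : ∀ {x σ π} → Avoids (x ∷ σ) π → Avoids σ π
avoids-tail av (τ , τ⊆σ , iso) = av (τ , _ ∷ʳ τ⊆σ , iso)

avoids₃-tail : ∀ {x σ} → Avoids₃ (x ∷ σ) → Avoids₃ σ
avoids₃-tail (a231 , a312 , a321) = avoids-tail a231 , avoids-tail a312 , avoids-tail a321

<-sameOrder : ∀ {a b p q} → a < b → p < q → SameOrder (a , p) (b , q)
<-sameOrder a<b p<q = (λ _ → p<q) , (λ _ → a<b)

>-sameOrder : ∀ {a b p q} → b < a → q < p → SameOrder (a , p) (b , q)
>-sameOrder b<a q<p = (λ a<b → ⊥-elim (<-asym a<b b<a)) , (λ p<q → ⊥-elim (<-asym p<q q<p))

contains₃ : ∀ {σ a b c p q r} → (a ∷ b ∷ c ∷ []) ⊆ σ →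
            SameOrder (a , p) (b , q) → SameOrder (a , p) (c , r) → SameOrder (b , q) (c , r) →
            Contains σ (p ∷ q ∷ r ∷ [])
contains₃ s ab ac bc = _ , s , refl , (ab ∷ ac ∷ []) ∷ (bc ∷ []) ∷ [] ∷ []

ordered-pair : ∀ {a b : ℕ} {xs} → a ∈ xs → b ∈ xs → a ≢ b → (a ∷ b ∷ []) ⊆ xs ⊎ (b ∷ a ∷ []) ⊆ xs
ordered-pair (here refl) (here refl) a≢b = ⊥-elim (a≢b refl)
ordered-pair (here refl) (there b∈)  _   = inj₁ (refl ∷ from∈ b∈)
ordered-pair (there a∈)  (here refl) _   = inj₂ (refl ∷ from∈ a∈)
ordered-pair (there a∈)  (there b∈)  a≢b = Sum.map (_ ∷ʳ_) (_ ∷ʳ_) (ordered-pair a∈ b∈ a≢b)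

first∈tail : ∀ {o m x τ} → x ∷ τ ↭ interval o (suc m) → suc o < x → suc o ∈ τ
first∈tail p o+1<x = ∈-tail (∈-resp-↭ (↭-sym p) (here refl)) (<⇒≢ o+1<x)

-- o+1 and o+2 both follow x, and either order completes a forbidden pattern.
head-above-two : ∀ {o m x τ} → x ∷ τ ↭ interval o (suc (suc m)) → suc (suc o) < x → ¬ Avoids₃ (x ∷ τ)
head-above-two {o} p o+2<x (_ , a312 , a321) =
  Sum.[ (λ s → a312 (contains₃ (refl ∷ s)
        (>-sameOrder o+1<x (s<s z<s)) (>-sameOrder o+2<x (s<s (s<s z<s))) (<-sameOrder (n<1+n _) (s<s z<s))))
  , (λ s → a321 (contains₃ (refl ∷ s)
        (>-sameOrder o+2<x (s<s (s<s z<s))) (>-sameOrder o+1<x (s<s z<s)) (>-sameOrder (n<1+n _) (s<s z<s))))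
  ] (ordered-pair (first∈tail p o+1<x) o+2∈τ (<⇒≢ (n<1+n _)))
  where
  o+1<x : suc o < _
  o+1<x = <-trans (n<1+n _) o+2<x
  o+2∈τ : suc (suc o) ∈ _
  o+2∈τ = ∈-tail (∈-resp-↭ (↭-sym p) (there (here refl))) (<⇒≢ o+2<x)

-- o+1 must follow o+2 and y, giving the pattern 231.
second-above-two : ∀ {o m y ρ} → suc (suc o) ∷ y ∷ ρ ↭ interval o (suc m) → suc (suc o) < y →
                   ¬ Avoids (suc (suc o) ∷ y ∷ ρ) p231
second-above-two {o} p o+2<y a231 =
  a231 (contains₃ (refl ∷ refl ∷ from∈ o+1∈ρ)
    (<-sameOrder o+2<y (s<s (s<s z<s))) (>-sameOrder (n<1+n _) (s<s z<s)) (>-sameOrder o+1<y (s<s z<s)))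
  where
  o+1<y : suc o < _
  o+1<y = <-trans (n<1+n _) o+2<y
  o+1∈ρ : suc o ∈ _
  o+1∈ρ = ∈-tail (first∈tail p (n<1+n _)) (<⇒≢ o+1<y)

unique-head≢second : ∀ {x y : ℕ} {ρ} → Unique (x ∷ y ∷ ρ) → x ≢ y
unique-head≢second ((x≢y ∷ _) ∷ _) = x≢y

avoider⇒Layered : ∀ {o m σ} → σ ↭ interval o m → Avoids₃ σ → Layered o m σ
avoider⇒Layered {m = zero}  {[]}    _ _ = []
avoider⇒Layered {m = suc _} {[]}    p _ = ⊥-elim (¬x∷xs↭[] (↭-sym p))
avoider⇒Layered {m = zero}  {_ ∷ _} p _ = ⊥-elim (¬x∷xs↭[] p)
avoider⇒Layered {m = suc m} {x ∷ τ} p av with ∈-resp-↭ p (here refl)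
... | here refl = layer₁ (avoider⇒Layered (drop-∷ p) (avoids₃-tail av))
avoider⇒Layered {m = suc zero} p av | there ()
avoider⇒Layered {m = suc (suc m)} p av | there (there x∈) = ⊥-elim (head-above-two p (interval-lower x∈) av)
avoider⇒Layered {m = suc (suc m)} {x ∷ []} p av | there (here refl) with first∈tail p (n<1+n _)
... | ()
avoider⇒Layered {m = suc (suc m)} {x ∷ y ∷ ρ} p av | there (here refl) with ∈-resp-↭ p (there (here refl))
... | here refl = layer₂ (avoider⇒Layered (drop-∷ (drop-∷ (trans p (swap _ _ refl))))
                                           (avoids₃-tail (avoids₃-tail av)))
... | there (here refl) = ⊥-elim (unique-head≢second (↭-interval-unique p) refl)
... | there (there y∈) = ⊥-elim (second-above-two p (interval-lower y∈) (proj₁ av))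

layereds : ℕ → ℕ → List (List ℕ)
layered₂s : ℕ → ℕ → List (List ℕ)

layereds o zero    = [ [] ]
layereds o (suc m) = map (suc o ∷_) (layereds (suc o) m) ++ layered₂s o m

-- the members of layereds o (suc m) whose first layer has size 2
layered₂s o zero    = []
layered₂s o (suc m) = map (λ w → suc (suc o) ∷ suc o ∷ w) (layereds (suc (suc o)) m)

Layered⇒∈ : ∀ {o m w} → Layered o m w → w ∈ layereds o m
Layered⇒∈ []         = here refl
Layered⇒∈ (layer₁ l) = ∈-++⁺ˡ (∈-map⁺ _ (Layered⇒∈ l))
Layered⇒∈ (layer₂ l) = ∈-++⁺ʳ _ (∈-map⁺ _ (Layered⇒∈ l))

∈⇒Layered : ∀ o m {w} → w ∈ layereds o m → Layered o m w
∈⇒Layered o zero (here refl) = []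
∈⇒Layered o (suc m) w∈ with ∈-++⁻ (map (suc o ∷_) (layereds (suc o) m)) w∈
... | inj₁ w∈₁ with ∈-map⁻ (suc o ∷_) w∈₁
...   | _ , v∈ , refl = layer₁ (∈⇒Layered (suc o) m v∈)
∈⇒Layered o (suc zero) w∈ | inj₂ ()
∈⇒Layered o (suc (suc m)) w∈ | inj₂ w∈₂ with ∈-map⁻ (λ w → suc (suc o) ∷ suc o ∷ w) w∈₂
...   | _ , v∈ , refl = layer₂ (∈⇒Layered (suc (suc o)) m v∈)

layer₁-layer₂-disjoint : ∀ o m → Disjoint (map (suc o ∷_) (layereds (suc o) m)) (layered₂s o m)
layer₁-layer₂-disjoint o (suc m) (v∈₁ , v∈₂) with ∈-map⁻ (suc o ∷_) v∈₁ | ∈-map⁻ _ v∈₂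
... | _ , _ , refl | _ , _ , eq = 1+n≢n (sym (∷-injectiveˡ eq))

layereds-unique : ∀ o m → Unique (layereds o m)
layered₂s-unique : ∀ o m → Unique (layered₂s o m)

layereds-unique o zero    = [] ∷ []
layereds-unique o (suc m) = Unique.++⁺ (Unique.map⁺ ∷-injectiveʳ (layereds-unique (suc o) m))
                                      (layered₂s-unique o m) (layer₁-layer₂-disjoint o m)

layered₂s-unique o zero    = []
layered₂s-unique o (suc m) = Unique.map⁺ (∷-injectiveʳ ∘ ∷-injectiveʳ) (layereds-unique (suc (suc o)) m)

length-layereds : ∀ o m → length (layereds o m) ≡ fib (suc m)
length-layered₂s : ∀ o m → length (layered₂s o m) ≡ fib m

length-layereds o zero    = refl
length-layereds o (suc m) = begin
  length (map (suc o ∷_) (layereds (suc o) m) ++ layered₂s o m)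
    ≡⟨ length-++ (map (suc o ∷_) (layereds (suc o) m)) ⟩
  length (map (suc o ∷_) (layereds (suc o) m)) + length (layered₂s o m)
    ≡⟨ cong₂ _+_ (≡-trans (length-map _ (layereds (suc o) m)) (length-layereds (suc o) m))
                 (length-layered₂s o m) ⟩
  fib (suc m) + fib m
    ∎
  where open ≡-Reasoning

length-layered₂s o zero    = refl
length-layered₂s o (suc m) = ≡-trans (length-map _ (layereds (suc (suc o)) m)) (length-layereds (suc (suc o)) m)

InB⇒∈ : ∀ {k σ} → InB (suc k) σ → σ ∈ map (1 ∷_) (layereds 1 k)
InB⇒∈ {k} {σ} (perm , ballot , av) with avoider⇒Layered (subst (σ ↭_) (map-suc-upTo (suc k)) perm) av
... | layer₁ l = ∈-map⁺ _ (Layered⇒∈ l)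
... | layer₂ _ with ballot 2
...   | ()

∈⇒InB : ∀ {k σ} → σ ∈ map (1 ∷_) (layereds 1 k) → InB (suc k) σ
∈⇒InB {k} σ∈ with ∈-map⁻ (1 ∷_) σ∈
... | τ , τ∈ , refl =
  subst (1 ∷ τ ↭_) (sym (map-suc-upTo (suc k))) (Layered⇒↭ l) ,
  Layered-ballot ≤-refl lτ ,
  ascending₁₃⇒avoids asc₁₃ (s<s z<s) ,
  ascending₁₃⇒avoids asc₁₃ (s<s (s<s z<s)) ,
  ascending₁₃⇒avoids asc₁₃ (s<s z<s)
  where
  lτ : Layered 1 k τ
  lτ = ∈⇒Layered 1 k τ∈
  l : Layered 0 (suc k) (1 ∷ τ)
  l = layer₁ lτ
  asc₁₃ : Ascending₁₃ (1 ∷ τ)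
  asc₁₃ = Layered⇒ascending₁₃ l

theorem4p8 : ∀ (n : ℕ) → 1 ≤ n → HasCard (InB n) (fib n)
theorem4p8 zero    ()
theorem4p8 (suc k) _ =
  map (1 ∷_) (layereds 1 k) ,
  Unique.map⁺ ∷-injectiveʳ (layereds-unique 1 k) ,
  (λ σ → ∈⇒InB , InB⇒∈) ,
  ≡-trans (length-map _ (layereds 1 k)) (length-layereds 1 k)
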